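{- Let $\Gamma=(V,E)$ be a finite undirected graph. The following conditions are equivalent: (i) there exist a function $F:\mathbb{N}\to\mathbb{N}$ and an integer $\ell>1$ such that, for all $k_1,\ldots,k_\ell\in\mathbb{N}$, $\lambda_{k_1,\ldots,k_\ell}(\Gamma)\le F(k_1)$; (ii) there exist a function $F:\mathbb{N}\to\mathbb{N}$ and an integer $\ell>1$ such that, for all $k_1,\ldots,k_\ell\in\mathbb{N}$, $\lambda_{k_1,\ldots,k_\ell}(\Gamma)= F(k_1)$; (iii) $\Gamma$ is a disjoint union of complete graphs, i.e. any two distinct vertices lying in the same connected component of $\Gamma$ are adjacent.
   Context: $\mathbb{N}$ denotes the set of positive integers. A graph is a finite directed graph without multiple edges, possibly with loops; a graph $(V,E)$ is undirected if $(u,v)\in E$ implies $(v,u)\in E$. For an undirected graph, $d(u,v)$ is the usual path distance. Given $k_1,\ldots,k_\ell\in\mathbb{N}$, an $L(k_1,\ldots,k_\ell)$-labelling of an undirected graph $\Gamma=(V,E)$ is a map $f:V\to\mathbb{N}$ such that $|f(u)-f(v)|\ge k_t$ whenever $d(u,v)=t$, for $t=1,\ldots,\ell$. The span of $f$ is the difference between its largest and smallest values, and $\lambda_{k_1,\ldots,k_\ell}(\Gamma)$ is the minimum span over all $L(k_1,\ldots,k_\ell)$-labellings of $\Gamma$. -}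

module Defs where

open import Data.Nat using (ℕ; zero; suc; _≤_; _<_; _⊔_; _⊓_; _∸_; ∣_-_∣)
open import Data.Fin using (Fin; toℕ)
import Data.Fin as Fin
open import Data.Vec using (tabulate; foldr₁)
open import Data.Bool using (Bool; true)
open import Data.Product using (Σ; ∃; _×_; _,_)
open import Relation.Binary.PropositionalEquality using (_≡_; _≢_)
open import Relation.Nullary using (¬_)

-- A finite graph on vertex set Fin n: adjacency given as a Bool-valued relation
-- (u , v) ∈ E  iff  E u v ≡ true.  Loops allowed, no multiple edges.
record Graph (n : ℕ) : Set where
  field
    E : Fin n → Fin n → Bool

open Graph public

Undirected : ∀ {n} → Graph n → Set
Undirected Γ = ∀ u v → E Γ u v ≡ true → E Γ v u ≡ true

data Walk {n} (Γ : Graph n) : Fin n → Fin n → ℕ → Set where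
  nil  : ∀ {u} → Walk Γ u u 0
  cons : ∀ {u w v t} → E Γ u w ≡ true → Walk Γ w v t → Walk Γ u v (suc t)

Dist : ∀ {n} → Graph n → Fin n → Fin n → ℕ → Set
Dist Γ u v t = Walk Γ u v t × (∀ s → s < t → ¬ Walk Γ u v s)

Connected : ∀ {n} → Graph n → Fin n → Fin n → Set
Connected Γ u v = ∃ λ t → Walk Γ u v t

-- L(k_1,...,k_ℓ)-labelling, with ks (t) standing for k_{t+1}; labels in positive integers
IsLabelling : ∀ {n ℓ} → Graph n → (Fin ℓ → ℕ) → (Fin n → ℕ) → Set
IsLabelling {n} {ℓ} Γ ks f =
  (∀ u → 1 ≤ f u) ×
  (∀ u v (t : Fin ℓ) → Dist Γ u v (suc (toℕ t)) → ks t ≤ ∣ f u - f v ∣)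

span : ∀ {n} → (Fin (suc n) → ℕ) → ℕ
span f = foldr₁ _⊔_ (tabulate f) ∸ foldr₁ _⊓_ (tabulate f)

IsLambda : ∀ {n ℓ} → Graph (suc n) → (Fin ℓ → ℕ) → ℕ → Set
IsLambda Γ ks m =
  (Σ _ λ f → IsLabelling Γ ks f × span f ≡ m) ×
  (∀ f → IsLabelling Γ ks f → m ≤ span f)

first : ∀ {ℓ} → 1 < ℓ → (Fin ℓ → ℕ) → ℕ
first {suc ℓ} _ ks = ks Fin.zero

Positive : ∀ {ℓ} → (Fin ℓ → ℕ) → Set
Positive ks = ∀ t → 1 ≤ ks t

CondI : ∀ {n} → Graph (suc n) → Set
CondI Γ = Σ (ℕ → ℕ) λ F → Σ ℕ λ ℓ → Σ (1 < ℓ) λ h →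
  ∀ (ks : Fin ℓ → ℕ) → Positive ks → ∀ m → IsLambda Γ ks m → m ≤ F (first h ks)

CondII : ∀ {n} → Graph (suc n) → Set
CondII Γ = Σ (ℕ → ℕ) λ F → Σ ℕ λ ℓ → Σ (1 < ℓ) λ h →
  ∀ (ks : Fin ℓ → ℕ) → Positive ks → ∀ m → IsLambda Γ ks m → m ≡ F (first h ks)

CondIII : ∀ {n} → Graph (suc n) → Set
CondIII Γ = ∀ u v → u ≢ v → Connected Γ u v → E Γ u v ≡ true

-- (i) ⇒ (iii): if two vertices of a component are not adjacent, some pair a, c is at
-- distance exactly 2.  Take k = (1, K, …, K) with K > F(1).  The labels 1 + K·x are
-- admissible, so a minimum span λ exists (up to double negation, enough to reach a
-- contradiction), yet every labelling already separates a and c by K > F(1) ≥ λ.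
-- (iii) ⇒ (ii), with ℓ = 2: distance 2 never occurs, so only k₁ matters.  Ranking each
-- vertex by its number of smaller neighbours makes u ↦ 1 + k₁·rank u a labelling, and
-- u with its smaller neighbours is a clique of rank u + 1 vertices, whose labels are
-- pairwise k₁ apart and so spread over at least k₁·rank u in any labelling.
module Submission where

open import Defs
open import Data.Nat using (ℕ; zero; suc; _+_; _*_; _∸_; _≤_; _<_; _⊔_; _⊓_; ∣_-_∣; z≤n; s≤s; _≤?_; NonZero)
open import Data.Nat.Properties
open import Data.Nat.DivMod using (_/_; _%_; m≡m%n+[m/n]*n; m%n<n; m<n*o⇒m/o<n)
open import Data.Fin using (Fin; toℕ; fromℕ<)
import Data.Fin as Fin
import Data.Fin.Properties as Fin
open import Data.Vec using (tabulate; foldr₁)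
open import Data.Bool using (true; false) renaming (_≟_ to _≟ᵇ_)
open import Data.List using (List; []; _∷_; length; lookup; filter; allFin)
open import Data.List.Relation.Unary.All using (All; _∷_)
import Data.List.Relation.Unary.All as All
open import Data.List.Relation.Unary.All.Properties using (all-filter)
open import Data.List.Relation.Unary.AllPairs using (AllPairs; _∷_)
open import Data.List.Relation.Unary.Unique.Propositional using (Unique)
import Data.List.Relation.Unary.Unique.Propositional.Properties as Unique
open import Data.List.Membership.Propositional using (_∈_)
open import Data.List.Membership.Propositional.Properties using (∈-lookup; ∈-allFin)
open import Data.List.Relation.Unary.Any using (here; there)
open import Data.Product using (∃; ∃₂; _×_; _,_)
open import Data.Sum using (_⊎_; inj₁; inj₂)
open import Data.Empty using (⊥-elim)
open import Relation.Nullary using (¬_; yes; no; contradiction)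
open import Relation.Nullary.Negation using (¬¬-map)
open import Relation.Nullary.Decidable using (_×-dec_)
open import Relation.Unary using (Decidable)
open import Relation.Binary using (tri<; tri≈; tri>)
open import Relation.Binary.PropositionalEquality
open import Function.Base using (_∘_)
open import Function.Bundles using (_⇔_; mk⇔)

m≢n⇒k≤∣k*m-k*n∣ : ∀ k {m n} → m ≢ n → k ≤ ∣ k * m - k * n ∣
m≢n⇒k≤∣k*m-k*n∣ k {m} {n} m≢n with ∣ m - n ∣ in eq
... | zero  = contradiction (∣m-n∣≡0⇒m≡n eq) m≢n
... | suc d = begin
  k                   ≤⟨ m≤m+n k (k * d) ⟩
  k + k * d           ≡⟨ *-suc k d ⟨
  k * suc d           ≡⟨ cong (k *_) eq ⟨
  k * ∣ m - n ∣       ≡⟨ *-distribˡ-∣-∣ k m n ⟩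
  ∣ k * m - k * n ∣   ∎
  where open ≤-Reasoning

∣m-n∣≤o∸p : ∀ {m n o p} → p ≤ m → p ≤ n → m ≤ o → n ≤ o → ∣ m - n ∣ ≤ o ∸ p
∣m-n∣≤o∸p {m} {n} p≤m p≤n m≤o n≤o with ∣m-n∣≡[m∸n]∨[n∸m] m n
... | inj₁ eq = subst (_≤ _) (sym eq) (∸-mono m≤o p≤n)
... | inj₂ eq = subst (_≤ _) (sym eq) (∸-mono n≤o p≤m)

∣m∸o-n∸o∣≡∣m-n∣ : ∀ {m n o} → o ≤ m → o ≤ n → ∣ m ∸ o - n ∸ o ∣ ≡ ∣ m - n ∣
∣m∸o-n∸o∣≡∣m-n∣ {m} {n} {o} o≤m o≤n = begin
  ∣ m ∸ o - n ∸ o ∣              ≡⟨ ∣m+n-m+o∣≡∣n-o∣ o (m ∸ o) (n ∸ o) ⟨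
  ∣ o + (m ∸ o) - o + (n ∸ o) ∣  ≡⟨ cong₂ ∣_-_∣ (m+[n∸m]≡n o≤m) (m+[n∸m]≡n o≤n) ⟩
  ∣ m - n ∣                      ∎
  where open ≡-Reasoning

/-≡⇒∣m-n∣<o : ∀ {m n o} .{{_ : NonZero o}} → m / o ≡ n / o → ∣ m - n ∣ < o
/-≡⇒∣m-n∣<o {m} {n} {o} same = begin-strict
  ∣ m - n ∣                                  ≡⟨ cong₂ ∣_-_∣ (split m) (split n) ⟩
  ∣ m / o * o + m % o - n / o * o + n % o ∣  ≡⟨ cong (λ q → ∣ m / o * o + m % o - q * o + n % o ∣) same ⟨
  ∣ m / o * o + m % o - m / o * o + n % o ∣  ≡⟨ ∣m+n-m+o∣≡∣n-o∣ (m / o * o) (m % o) (n % o) ⟩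
  ∣ m % o - n % o ∣                          ≤⟨ ∣m-n∣≤m⊔n (m % o) (n % o) ⟩
  m % o ⊔ n % o                              <⟨ ⊔-lub (m%n<n m o) (m%n<n n o) ⟩
  o                                          ∎
  where
    open ≤-Reasoning
    split : ∀ x → x ≡ x / o * o + x % o
    split x = trans (m≡m%n+[m/n]*n x o) (+-comm (x % o) (x / o * o))

-- If k·c > M ∸ L, the buckets (h i ∸ L) / k take fewer than c + 1 values (pigeonhole),
-- and two values sharing a bucket are less than k apart.
gapped-spread : ∀ k {c} (h : Fin (suc c) → ℕ) {L M} →
                (∀ {i j} → i Fin.< j → k ≤ ∣ h i - h j ∣) →
                (∀ i → L ≤ h i) → (∀ i → h i ≤ M) → k * c ≤ M ∸ L
gapped-spread zero        h gap L≤h h≤M = z≤n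
gapped-spread k@(suc _) {c} h {L} {M} gap L≤h h≤M with k * c ≤? M ∸ L
... | yes kc≤M∸L = kc≤M∸L
... | no  kc≰M∸L =
  let i , j , i<j , same = Fin.pigeonhole (n<1+n c) bucket
  in contradiction (gap i<j) (<⇒≱ (close same))
  where
    bucket< : ∀ i → (h i ∸ L) / k < c
    bucket< i = m<n*o⇒m/o<n (begin-strict
      h i ∸ L  ≤⟨ ∸-monoˡ-≤ L (h≤M i) ⟩
      M ∸ L    <⟨ ≰⇒> kc≰M∸L ⟩
      k * c    ≡⟨ *-comm k c ⟩
      c * k    ∎)
      where open ≤-Reasoning
    bucket : Fin (suc c) → Fin c
    bucket i = fromℕ< (bucket< i)
    close : ∀ {i j} → bucket i ≡ bucket j → ∣ h i - h j ∣ < k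
    close {i} {j} same = subst (_< k) (∣m∸o-n∸o∣≡∣m-n∣ (L≤h i) (L≤h j))
      (/-≡⇒∣m-n∣<o {h i ∸ L} {h j ∸ L} (trans (sym (Fin.toℕ-fromℕ< (bucket< i)))
                   (trans (cong toℕ same) (Fin.toℕ-fromℕ< (bucket< j)))))

¬¬-least : ∀ {P : ℕ → Set} {n} → P n → ¬ ¬ (∃ λ m → P m × ∀ {k} → P k → m ≤ k)
¬¬-least {P} {n} = below n ≤-refl
  where
    below : ∀ b {n} → n ≤ b → P n → ¬ ¬ (∃ λ m → P m × ∀ {k} → P k → m ≤ k)
    below zero    z≤n  p0 no-least = no-least (0 , p0 , λ _ → z≤n)
    below (suc b) {n} n≤b pn no-least = no-least (n , pn , minimal)
      where
        minimal : ∀ {k} → P k → n ≤ k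
        minimal {k} pk with n ≤? k
        ... | yes n≤k = n≤k
        ... | no  n≰k = ⊥-elim (below b (≤-pred (≤-trans (≰⇒> n≰k) n≤b)) pk no-least)

max min : ∀ {n} → (Fin (suc n) → ℕ) → ℕ
max f = foldr₁ _⊔_ (tabulate f)
min f = foldr₁ _⊓_ (tabulate f)

f≤max : ∀ {n} (f : Fin (suc n) → ℕ) i → f i ≤ max f
f≤max {zero}  f Fin.zero    = ≤-refl
f≤max {suc n} f Fin.zero    = m≤m⊔n _ _
f≤max {suc n} f (Fin.suc i) = ≤-trans (f≤max (f ∘ Fin.suc) i) (m≤n⊔m (f Fin.zero) _)

max-lub : ∀ {n} (f : Fin (suc n) → ℕ) {M} → (∀ i → f i ≤ M) → max f ≤ M
max-lub {zero}  f f≤M = f≤M Fin.zero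
max-lub {suc n} f f≤M = ⊔-lub (f≤M Fin.zero) (max-lub (f ∘ Fin.suc) (f≤M ∘ Fin.suc))

min≤f : ∀ {n} (f : Fin (suc n) → ℕ) i → min f ≤ f i
min≤f {zero}  f Fin.zero    = ≤-refl
min≤f {suc n} f Fin.zero    = m⊓n≤m _ _
min≤f {suc n} f (Fin.suc i) = ≤-trans (m⊓n≤n (f Fin.zero) _) (min≤f (f ∘ Fin.suc) i)

min-glb : ∀ {n} (f : Fin (suc n) → ℕ) {L} → (∀ i → L ≤ f i) → L ≤ min f
min-glb {zero}  f L≤f = L≤f Fin.zero
min-glb {suc n} f L≤f = ⊓-glb (L≤f Fin.zero) (min-glb (f ∘ Fin.suc) (L≤f ∘ Fin.suc))

span≤ : ∀ {n} (f : Fin (suc n) → ℕ) {L M} → (∀ i → L ≤ f i) → (∀ i → f i ≤ M) → span f ≤ M ∸ L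
span≤ f L≤f f≤M = ∸-mono (max-lub f f≤M) (min-glb f L≤f)

∣f-f∣≤span : ∀ {n} (f : Fin (suc n) → ℕ) i j → ∣ f i - f j ∣ ≤ span f
∣f-f∣≤span f i j = ∣m-n∣≤o∸p (min≤f f i) (min≤f f j) (f≤max f i) (f≤max f j)

module _ {A : Set} {P Q : A → Set} (P? : Decidable P) (Q? : Decidable Q) (P⇒Q : ∀ {x} → P x → Q x) where

  length-filter-mono : ∀ xs → length (filter P? xs) ≤ length (filter Q? xs)
  length-filter-mono []       = z≤n
  length-filter-mono (x ∷ xs) with P? x | Q? x
  ... | yes _  | yes _  = s≤s (length-filter-mono xs)
  ... | yes px | no ¬qx = contradiction (P⇒Q px) ¬qx
  ... | no _   | yes _  = m≤n⇒m≤1+n (length-filter-mono xs)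
  ... | no _   | no _   = length-filter-mono xs

  length-filter-strict : ∀ {y xs} → y ∈ xs → ¬ P y → Q y → length (filter P? xs) < length (filter Q? xs)
  length-filter-strict {xs = x ∷ xs} (here refl) ¬py qy with P? x | Q? x
  ... | yes py | _      = contradiction py ¬py
  ... | no _   | yes _  = s≤s (length-filter-mono xs)
  ... | no _   | no ¬qy = contradiction qy ¬qy
  length-filter-strict {xs = x ∷ xs} (there y∈xs) ¬py qy with P? x | Q? x
  ... | yes _  | yes _  = s≤s (length-filter-strict y∈xs ¬py qy)
  ... | yes px | no ¬qx = contradiction (P⇒Q px) ¬qx
  ... | no _   | yes _  = m≤n⇒m≤1+n (length-filter-strict y∈xs ¬py qy)
  ... | no _   | no _   = length-filter-strict y∈xs ¬py qy

AllPairs-lookup : ∀ {A : Set} {R : A → A → Set} {xs} → AllPairs R xs →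
                  ∀ {i j} → i Fin.< j → R (lookup xs i) (lookup xs j)
AllPairs-lookup (Rx ∷ _)   {Fin.zero}  {Fin.suc j} _         = All.lookup Rx (∈-lookup j)
AllPairs-lookup (_  ∷ Rxs) {Fin.suc i} {Fin.suc j} (s≤s i<j) = AllPairs-lookup Rxs i<j

module _ {n} {Γ : Graph n} where

  Walk0⇒≡ : ∀ {u v} → Walk Γ u v 0 → u ≡ v
  Walk0⇒≡ nil = refl

  Dist⇒≢ : ∀ {u v t} → Dist Γ u v (suc t) → u ≢ v
  Dist⇒≢ (_ , no-shorter) refl = no-shorter 0 (s≤s z≤n) nil

  edge⇒Dist1 : ∀ {u v} → E Γ u v ≡ true → u ≢ v → Dist Γ u v 1
  edge⇒Dist1 uv u≢v = cons uv nil , λ { zero _ w → u≢v (Walk0⇒≡ w) ; (suc _) (s≤s ()) _ }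

  Dist1⇒edge : ∀ {u v} → Dist Γ u v 1 → E Γ u v ≡ true
  Dist1⇒edge (cons uv nil , _) = uv

  path2⇒Dist2 : ∀ {a b c} → E Γ a b ≡ true → E Γ b c ≡ true → a ≢ c → E Γ a c ≡ false →
                Dist Γ a c 2
  path2⇒Dist2 ab bc a≢c ¬ac = cons ab (cons bc nil) , shorter
    where
      shorter : ∀ s → s < 2 → ¬ Walk Γ _ _ s
      shorter zero          _                 w              = a≢c (Walk0⇒≡ w)
      shorter (suc zero)    _                 (cons ac nil)  = contradiction (trans (sym ac) ¬ac) λ ()
      shorter (suc (suc _)) (s≤s (s≤s ()))    _

  nonadjacent⇒Dist2 : ∀ {u v t} → Walk Γ u v t → u ≢ v → E Γ u v ≡ false →
                      ∃₂ λ a c → Dist Γ a c 2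
  nonadjacent⇒Dist2 nil u≢v _ = contradiction refl u≢v
  nonadjacent⇒Dist2 {u} {v} (cons {w = w} uw w⇝v) u≢v ¬uv with w Fin.≟ v
  ... | yes refl = contradiction (trans (sym uw) ¬uv) λ ()
  ... | no w≢v with E Γ w v in wv
  ...   | true  = u , v , path2⇒Dist2 uw wv u≢v ¬uv
  ...   | false = nonadjacent⇒Dist2 w⇝v w≢v wv

module _ {n} {Γ : Graph (suc n)} where

  CondIII⇒¬Dist2+ : CondIII Γ → ∀ {u v t} → ¬ Dist Γ u v (suc (suc t))
  CondIII⇒¬Dist2+ complete d@(walk , no-shorter) =
    no-shorter 1 (s≤s (s≤s z≤n)) (cons (complete _ _ (Dist⇒≢ d) (_ , walk)) nil)

  index-isLabelling : ∀ {ℓ} {ks : Fin ℓ → ℕ} {K} → (∀ t → ks t ≤ K) →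
                      IsLabelling Γ ks (λ x → suc (K * toℕ x))
  index-isLabelling {K = K} ks≤K = (λ _ → s≤s z≤n) , λ u v t d →
    ≤-trans (ks≤K t) (m≢n⇒k≤∣k*m-k*n∣ K (Dist⇒≢ d ∘ Fin.toℕ-injective))

  Dist⇒k≤span : ∀ {ℓ} {ks : Fin ℓ → ℕ} {f u v} t → IsLabelling Γ ks f →
                Dist Γ u v (suc (toℕ t)) → ks t ≤ span f
  Dist⇒k≤span {f = f} {u} {v} t (_ , separated) d = ≤-trans (separated u v t d) (∣f-f∣≤span f u v)

  ¬¬-IsLambda : ∀ {ℓ} {ks : Fin ℓ → ℕ} {f} → IsLabelling Γ ks f → ¬ ¬ ∃ (IsLambda Γ ks)
  ¬¬-IsLambda lf = ¬¬-map (λ (m , attained , least) → m , attained , λ g lg → least (g , lg , refl))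
                          (¬¬-least (_ , lf , refl))

  clique-span : ∀ {ℓ} {ks : Fin (suc ℓ) → ℕ} {f c} → IsLabelling Γ ks f →
                (v : Fin (suc c) → Fin (suc n)) → (∀ {i j} → i Fin.< j → Dist Γ (v i) (v j) 1) →
                ks Fin.zero * c ≤ span f
  clique-span {ks = ks} {f} (_ , separated) v adjacent =
    gapped-spread (ks Fin.zero) (f ∘ v) (λ i<j → separated _ _ Fin.zero (adjacent i<j))
                  (min≤f f ∘ v) (f≤max f ∘ v)

  CondI⇒CondIII : CondI Γ → CondIII Γ
  CondI⇒CondIII (F , suc (suc ℓ) , s≤s (s≤s z≤n) , bounded) u v u≢v (_ , u⇝v) with E Γ u v in uv
  ... | true  = refl
  ... | false with nonadjacent⇒Dist2 u⇝v u≢v uv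
  ...   | a , c , ac = ⊥-elim (¬¬-IsLambda (index-isLabelling ks≤K) no-IsLambda)
    where
      K : ℕ
      K = suc (F 1)
      ks : Fin (suc (suc ℓ)) → ℕ
      ks Fin.zero    = 1
      ks (Fin.suc _) = K
      ks≤K : ∀ t → ks t ≤ K
      ks≤K Fin.zero    = s≤s z≤n
      ks≤K (Fin.suc _) = ≤-refl
      positive : Positive ks
      positive Fin.zero    = ≤-refl
      positive (Fin.suc _) = s≤s z≤n
      no-IsLambda : ¬ ∃ (IsLambda Γ ks)
      no-IsLambda (m , isλ@((f , lf , span≡m) , _)) = 1+n≰n (begin
        K       ≤⟨ Dist⇒k≤span (Fin.suc Fin.zero) lf ac ⟩
        span f  ≡⟨ span≡m ⟩
        m       ≤⟨ bounded ks positive m isλ ⟩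
        F 1     ∎)
        where open ≤-Reasoning

module CliqueUnion {n} (Γ : Graph (suc n)) (undirected : Undirected Γ) (complete : CondIII Γ) where

  Vertex : Set
  Vertex = Fin (suc n)

  two-step : ∀ {a b c} → E Γ a b ≡ true → E Γ b c ≡ true → a ≢ c → E Γ a c ≡ true
  two-step ab bc a≢c = complete _ _ a≢c (2 , cons ab (cons bc nil))

  SmallerNeighbour : Vertex → Vertex → Set
  SmallerNeighbour u w = w Fin.< u × E Γ u w ≡ true

  smallerNeighbour? : ∀ u → Decidable (SmallerNeighbour u)
  smallerNeighbour? u w = (w Fin.<? u) ×-dec (E Γ u w ≟ᵇ true)

  rank : Vertex → ℕ
  rank u = length (filter (smallerNeighbour? u) (allFin _))

  rank-< : ∀ {u v} → v Fin.< u → E Γ u v ≡ true → rank v < rank u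
  rank-< {u} {v} v<u uv =
    length-filter-strict (smallerNeighbour? v) (smallerNeighbour? u) inherited
      (∈-allFin v) (λ (v<v , _) → Fin.<-irrefl refl v<v) (v<u , uv)
    where
      inherited : ∀ {w} → SmallerNeighbour v w → SmallerNeighbour u w
      inherited (w<v , vw) = let w<u = Fin.<-trans w<v v<u in
        w<u , two-step uv vw (λ u≡w → Fin.<-irrefl (sym u≡w) w<u)

  rank-injective : ∀ {u v} → Dist Γ u v 1 → rank u ≢ rank v
  rank-injective {u} {v} d with Fin.<-cmp u v
  ... | tri< u<v _ _ = <⇒≢ (rank-< u<v (undirected u v (Dist1⇒edge d)))
  ... | tri≈ _ u≡v _ = contradiction u≡v (Dist⇒≢ d)
  ... | tri> _ _ v<u = ≢-sym (<⇒≢ (rank-< v<u (Dist1⇒edge d)))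

  label : ℕ → Vertex → ℕ
  label k u = suc (k * rank u)

  label-isLabelling : (ks : Fin 2 → ℕ) → IsLabelling Γ ks (label (ks Fin.zero))
  label-isLabelling ks = (λ _ → s≤s z≤n) , separated
    where
      separated : ∀ u v (t : Fin 2) → Dist Γ u v (suc (toℕ t)) →
                  ks t ≤ ∣ label (ks Fin.zero) u - label (ks Fin.zero) v ∣
      separated u v Fin.zero              d = m≢n⇒k≤∣k*m-k*n∣ (ks Fin.zero) (rank-injective d)
      separated u v (Fin.suc Fin.zero)    d = contradiction d (CondIII⇒¬Dist2+ complete)

  block : Vertex → List Vertex
  block u = u ∷ filter (smallerNeighbour? u) (allFin _)

  block-unique : ∀ u → Unique (block u)
  block-unique u = All.map (λ (w<u , _) u≡w → Fin.<-irrefl (sym u≡w) w<u) (all-filter (smallerNeighbour? u) (allFin _))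
                 ∷ Unique.filter⁺ (smallerNeighbour? u) (Unique.allFin⁺ _)

  block-near : ∀ u → All (λ w → w ≡ u ⊎ E Γ u w ≡ true) (block u)
  block-near u = inj₁ refl ∷ All.map (λ (_ , uw) → inj₂ uw) (all-filter (smallerNeighbour? u) (allFin _))

  near⇒adjacent : ∀ {u a b} → a ≡ u ⊎ E Γ u a ≡ true → b ≡ u ⊎ E Γ u b ≡ true → a ≢ b →
                  E Γ a b ≡ true
  near⇒adjacent (inj₁ refl) (inj₁ refl) a≢b = contradiction refl a≢b
  near⇒adjacent (inj₁ refl) (inj₂ ub)   _   = ub
  near⇒adjacent (inj₂ ua)   (inj₁ refl) _   = undirected _ _ ua
  near⇒adjacent (inj₂ ua)   (inj₂ ub)   a≢b = two-step (undirected _ _ ua) ub a≢b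

  block-clique : ∀ u {i j} → i Fin.< j → Dist Γ (lookup (block u) i) (lookup (block u) j) 1
  block-clique u {i} {j} i<j = edge⇒Dist1 (near⇒adjacent (near i) (near j) distinct) distinct
    where
      near : ∀ i → lookup (block u) i ≡ u ⊎ E Γ u (lookup (block u) i) ≡ true
      near i = All.lookup (block-near u) (∈-lookup i)
      distinct : lookup (block u) i ≢ lookup (block u) j
      distinct = AllPairs-lookup (block-unique u) i<j

  rank≤span : ∀ {ℓ} {ks : Fin (suc ℓ) → ℕ} {f} → IsLabelling Γ ks f → ∀ u → ks Fin.zero * rank u ≤ span f
  rank≤span lf u = clique-span lf (lookup (block u)) (block-clique u)

  span-label≤span : ∀ {ℓ} {ks : Fin (suc ℓ) → ℕ} {f} → IsLabelling Γ ks f → span (label (ks Fin.zero)) ≤ span f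
  span-label≤span lf = span≤ _ (λ _ → s≤s z≤n) (λ u → s≤s (rank≤span lf u))

  condII : CondII Γ
  condII = (λ k → span (label k)) , 2 , s≤s (s≤s z≤n) , λ where
    ks _ m ((f , lf , refl) , least) → ≤-antisym (least _ (label-isLabelling ks)) (span-label≤span lf)

theorem4 : ∀ {n} (Γ : Graph (suc n)) → Undirected Γ →
    (CondI Γ ⇔ CondIII Γ) × (CondII Γ ⇔ CondIII Γ)
theorem4 Γ undirected =
  mk⇔ CondI⇒CondIII (CondII⇒CondI ∘ CondIII⇒CondII) ,
  mk⇔ (CondI⇒CondIII ∘ CondII⇒CondI) CondIII⇒CondII
  where
    CondIII⇒CondII : CondIII Γ → CondII Γ
    CondIII⇒CondII = CliqueUnion.condII Γ undirected
    CondII⇒CondI : CondII Γ → CondI Γ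
    CondII⇒CondI (F , ℓ , 1<ℓ , exact) = F , ℓ , 1<ℓ , λ ks pos m isλ → ≤-reflexive (exact ks pos m isλ)
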